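{- Let $X$ and $Y$ be strings, $k\ge 0$ and $\ell\ge 1$ integers, and $S(\ell)$ a fixed $\ell$-cover. If $\mathrm{LCF}_k(X,Y)\ge \ell$, then $$\mathrm{LCF}_k(X,Y)=\max_{p+q=k}\{\mathrm{LCP}_p(U_1,V_1)+\mathrm{LCP}_q(U_2,V_2) : (U_1,U_2)\in \mathrm{Pairs}_\ell(X),\ (V_1,V_2)\in\mathrm{Pairs}_\ell(Y)\},$$ where the maximum ranges over non-negative integers $p,q$ with $p+q=k$.
   Context: Strings are indexed from 1; $U[i..j]=U[i]\cdots U[j]$, $U[..i]=U[1..i]$, $U[i..]=U[i..|U|]$, and $U^R$ is the reversal of $U$. For equal-length strings, $d_H(U,V)=|\{i: U[i]\ne V[i]\}|$. $\mathrm{LCF}_k(X,Y)$ is the maximum length $m$ such that some length-$m$ factor of $X$ and some length-$m$ factor of $Y$ have Hamming distance at most $k$. For strings $U,V$ and integer $d\ge0$, $\mathrm{LCP}_d(U,V)=\max\{p\le |U|,|V| : d_H(U[1..p],V[1..p])\le d\}$. A set $S(d)\subseteq\mathbb{Z}_+$ is a $d$-cover if there is a function $h$ such that for all $i,j\in\mathbb{Z}_+$, $0\le h(i,j)<d$ and $i+h(i,j),\,j+h(i,j)\in S(d)$. For a string $U$, $\mathrm{Pairs}_\ell(U)=\{((U[..i-1])^R, U[i..]) : i\in S(\ell)\cap[1..|U|]\}$. -}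

module Defs where

open import Data.Nat using (ℕ; zero; suc; _+_; _∸_; _≤_; _<_)
open import Data.List using (List; []; _∷_; length; take; drop; reverse; _++_)
open import Data.Product using (Σ; ∃; ∃-syntax; _×_; _,_)
open import Relation.Binary.Definitions using (DecidableEquality)
open import Relation.Binary.PropositionalEquality using (_≡_)
open import Relation.Nullary using (yes; no)

-- A set S ⊆ ℤ+ is represented by a predicate on ℕ (only positive elements matter).
-- d-cover: ∃ h with 0 ≤ h(i,j) < d and i+h(i,j), j+h(i,j) ∈ S, for all i,j ∈ ℤ+.
IsCover : ℕ → (ℕ → Set) → Set
IsCover d S =
  Σ (ℕ → ℕ → ℕ) λ h → ∀ i j → 1 ≤ i → 1 ≤ j →
    (h i j < d) × S (i + h i j) × S (j + h i j)

IsMax : (ℕ → Set) → ℕ → Set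
IsMax P m = P m × (∀ m′ → P m′ → m′ ≤ m)

module _ {A : Set} (eq? : DecidableEquality A) where

  -- Hamming distance (applied only to equal-length strings).
  dH : List A → List A → ℕ
  dH [] _ = 0
  dH (_ ∷ _) [] = 0
  dH (a ∷ u) (b ∷ v) with eq? a b
  ... | yes _ = dH u v
  ... | no  _ = suc (dH u v)

  Factor : ℕ → List A → List A → Set
  Factor m X F = length F ≡ m × ∃[ u ] ∃[ v ] (X ≡ u ++ (F ++ v))

  LCFCand : ℕ → List A → List A → ℕ → Set
  LCFCand k X Y m = ∃[ F ] ∃[ G ] (Factor m X F × Factor m Y G × dH F G ≤ k)

  IsLCF : ℕ → List A → List A → ℕ → Set
  IsLCF k X Y = IsMax (LCFCand k X Y)

  LCPCand : ℕ → List A → List A → ℕ → Set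
  LCPCand d U V p = p ≤ length U × p ≤ length V × dH (take p U) (take p V) ≤ d

  IsLCP : ℕ → List A → List A → ℕ → Set
  IsLCP d U V = IsMax (LCPCand d U V)

  -- (P₁,P₂) ∈ Pairs_ℓ(U) w.r.t. the cover S = S(ℓ):
  -- ∃ i ∈ S ∩ [1..|U|], P₁ = (U[..i-1])^R, P₂ = U[i..].
  InPairs : (ℕ → Set) → List A → List A → List A → Set
  InPairs S U P₁ P₂ = ∃[ i ] (1 ≤ i × i ≤ length U × S i ×
    P₁ ≡ reverse (take (i ∸ 1) U) × P₂ ≡ drop (i ∸ 1) U)

  RHSCand : (ℕ → Set) → ℕ → List A → List A → ℕ → Set
  RHSCand S k X Y s =
    ∃[ p ] ∃[ q ] ∃[ U₁ ] ∃[ U₂ ] ∃[ V₁ ] ∃[ V₂ ] ∃[ a ] ∃[ b ]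
      (p + q ≡ k × InPairs S X U₁ U₂ × InPairs S Y V₁ V₂ ×
       IsLCP p U₁ V₁ a × IsLCP q U₂ V₂ b × s ≡ a + b)

module Submission where

-- Proof of Lemma 4.  Write m = LCF_k(X,Y) and call a triple (anchor in X,
-- anchor in Y, split p+q=k) a candidate, with value LCP_p(U₁,V₁)+LCP_q(U₂,V₂).
--
-- (≤) Every candidate value is at most m (rhs≤lcf): if LCP_p(U₁,V₁)=a and
--     LCP_q(U₂,V₂)=b, the a characters left of the anchor followed by the b
--     characters from it form a factor of length a+b (gluedFactor), in X and in Y,
--     and the Hamming distance of these factors is at most p+q=k, because it
--     splits over concatenation (dH-++) and is invariant under reversal (dH-reverse).
-- (attained) Let F = X[u+1..u+m] and G = Y[u′+1..u′+m] witness m.  The cover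
--     gives h < ℓ ≤ m with |u|+1+h, |u′|+1+h ∈ S(ℓ).  Cutting F and G after h
--     characters (cut-inside) and choosing q = mismatches right of the cut,
--     p = k-q, the two halves are common prefixes of the anchored pairs, so the
--     LCPs are at least h and m-h (common-prefix≤LCP): the candidate is ≥ m
--     (cut-candidate), hence = m by (≤) (lcf-attained).

open import Defs
open import Data.Nat using (ℕ; zero; suc; _+_; _∸_; _⊓_; _≤_; _<_; z≤n; s≤s; s≤s⁻¹; _≤?_)
open import Data.Nat.Properties
open import Data.List using (List; []; _∷_; length; take; drop; reverse; _++_; [_])
open import Data.List.Properties
  using (length-++; length-take; length-reverse; length-drop; reverse-++;
         reverse-involutive; take++drop≡id; take-all; unfold-reverse; ++-assoc)
open import Data.Product using (∃; ∃-syntax; _×_; _,_; proj₁; proj₂)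
open import Relation.Binary.Definitions using (DecidableEquality)
open import Relation.Binary.PropositionalEquality hiding ([_])
open import Relation.Nullary using (Dec; yes; no)
open import Relation.Nullary.Decidable using (_×-dec_)

boundedMax : (P : ℕ → Set) → (∀ n → Dec (P n)) → P 0 → (B : ℕ) →
             (∀ n → P n → n ≤ B) → ∃ (IsMax P)
boundedMax P P? P0 zero bounded = 0 , P0 , bounded
boundedMax P P? P0 (suc B) bounded with P? (suc B)
... | yes PB = suc B , PB , bounded
... | no ¬PB = boundedMax P P? P0 B bounded′
  where
  bounded′ : ∀ n → P n → n ≤ B
  bounded′ n Pn = s≤s⁻¹ (≤∧≢⇒< (bounded n Pn) (λ n≡B → ¬PB (subst P n≡B Pn)))

module _ {A : Set} where

  length-take-≤ : ∀ n (xs : List A) → n ≤ length xs → length (take n xs) ≡ n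
  length-take-≤ n xs n≤ = trans (length-take n xs) (m≤n⇒m⊓n≡m n≤)

  take-++-≤ : ∀ n (xs ys : List A) → n ≤ length xs → take n (xs ++ ys) ≡ take n xs
  take-++-≤ zero    xs       ys n≤       = refl
  take-++-≤ (suc n) (x ∷ xs) ys (s≤s n≤) = cong (x ∷_) (take-++-≤ n xs ys n≤)

  drop-++-≤ : ∀ n (xs ys : List A) → n ≤ length xs → drop n (xs ++ ys) ≡ drop n xs ++ ys
  drop-++-≤ zero    xs       ys n≤       = refl
  drop-++-≤ (suc n) (x ∷ xs) ys (s≤s n≤) = drop-++-≤ n xs ys n≤

  take-++-beyond : ∀ n (xs ys : List A) → take (length xs + n) (xs ++ ys) ≡ xs ++ take n ys
  take-++-beyond n []       ys = refl
  take-++-beyond n (x ∷ xs) ys = cong (x ∷_) (take-++-beyond n xs ys)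

  drop-++-beyond : ∀ n (xs ys : List A) → drop (length xs + n) (xs ++ ys) ≡ drop n ys
  drop-++-beyond n []       ys = refl
  drop-++-beyond n (x ∷ xs) ys = drop-++-beyond n xs ys

  cut-inside : ∀ h (u F v : List A) → h ≤ length F →
    reverse (take (length u + h) (u ++ (F ++ v))) ≡ reverse (take h F) ++ reverse u
    × drop (length u + h) (u ++ (F ++ v)) ≡ drop h F ++ v
  cut-inside h u F v h≤ =
    trans (cong reverse (trans (take-++-beyond h u (F ++ v)) (cong (u ++_) (take-++-≤ h F v h≤))))
          (reverse-++ u (take h F)) ,
    trans (drop-++-beyond h u (F ++ v)) (drop-++-≤ h F v h≤)

  reverse-split : ∀ n (xs : List A) →
    xs ≡ reverse (drop n (reverse xs)) ++ reverse (take n (reverse xs))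
  reverse-split n xs = begin
    xs                                              ≡⟨ sym (reverse-involutive xs) ⟩
    reverse (reverse xs)                            ≡⟨ cong reverse (sym (take++drop≡id n (reverse xs))) ⟩
    reverse (take n (reverse xs) ++ drop n (reverse xs)) ≡⟨ reverse-++ (take n (reverse xs)) _ ⟩
    reverse (drop n (reverse xs)) ++ reverse (take n (reverse xs)) ∎
    where open ≡-Reasoning

module _ {A : Set} (eq? : DecidableEquality A) where

  private
    d : List A → List A → ℕ
    d = dH eq?

  dH-++ : (xs ys xs′ ys′ : List A) → length xs ≡ length ys →
          d (xs ++ xs′) (ys ++ ys′) ≡ d xs ys + d xs′ ys′
  dH-++ []       []       xs′ ys′ _ = refl
  dH-++ (x ∷ xs) (y ∷ ys) xs′ ys′ e with eq? x y
  ... | yes _ = dH-++ xs ys xs′ ys′ (suc-injective e)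
  ... | no  _ = cong suc (dH-++ xs ys xs′ ys′ (suc-injective e))

  dH-split : ∀ h (F G : List A) → length F ≡ length G →
             d F G ≡ d (take h F) (take h G) + d (drop h F) (drop h G)
  dH-split h F G |F|≡|G| =
    trans (cong₂ d (sym (take++drop≡id h F)) (sym (take++drop≡id h G)))
          (dH-++ (take h F) (take h G) _ _ (trans (length-take h F)
                                            (trans (cong (h ⊓_) |F|≡|G|) (sym (length-take h G)))))

  dH-reverse : (xs ys : List A) → length xs ≡ length ys →
               d (reverse xs) (reverse ys) ≡ d xs ys
  dH-reverse []       []       _ = refl
  dH-reverse (x ∷ xs) (y ∷ ys) e rewrite unfold-reverse x xs | unfold-reverse y ys = begin
    d (reverse xs ++ [ x ]) (reverse ys ++ [ y ])
      ≡⟨ dH-++ (reverse xs) (reverse ys) [ x ] [ y ]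
           (trans (length-reverse xs) (trans (suc-injective e) (sym (length-reverse ys)))) ⟩
    d (reverse xs) (reverse ys) + d [ x ] [ y ]
      ≡⟨ cong (_+ d [ x ] [ y ]) (dH-reverse xs ys (suc-injective e)) ⟩
    d xs ys + d [ x ] [ y ]    ≡⟨ +-comm (d xs ys) _ ⟩
    d [ x ] [ y ] + d xs ys    ≡⟨ sym (dH-++ [ x ] [ y ] xs ys refl) ⟩
    d (x ∷ xs) (y ∷ ys)        ∎
    where open ≡-Reasoning

  gluedFactor : (X : List A) (c a b : ℕ) →
    a ≤ length (reverse (take c X)) → b ≤ length (drop c X) →
    Factor eq? (a + b) X (reverse (take a (reverse (take c X))) ++ take b (drop c X))
  gluedFactor X c a b a≤ b≤ = |L++R| , reverse (drop a (reverse (take c X))) , drop b (drop c X) , X≡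
    where
    L = reverse (take a (reverse (take c X)))
    pre = reverse (drop a (reverse (take c X)))
    R = drop c X
    |L++R| : length (L ++ take b R) ≡ a + b
    |L++R| = trans (length-++ L) (cong₂ _+_
               (trans (length-reverse (take a (reverse (take c X)))) (length-take-≤ a _ a≤))
               (length-take-≤ b R b≤))
    X≡ : X ≡ pre ++ ((L ++ take b R) ++ drop b R)
    X≡ = begin
      X                                   ≡⟨ sym (take++drop≡id c X) ⟩
      take c X ++ R                       ≡⟨ cong₂ _++_ (reverse-split a (take c X)) (sym (take++drop≡id b R)) ⟩
      (pre ++ L) ++ (take b R ++ drop b R) ≡⟨ ++-assoc pre L _ ⟩
      pre ++ (L ++ (take b R ++ drop b R)) ≡⟨ cong (pre ++_) (sym (++-assoc L (take b R) (drop b R))) ⟩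
      pre ++ ((L ++ take b R) ++ drop b R) ∎
      where open ≡-Reasoning

  rhs≤lcf : (S : ℕ → Set) (k : ℕ) (X Y : List A) (m : ℕ) → IsLCF eq? k X Y m →
            ∀ s → RHSCand eq? S k X Y s → s ≤ m
  rhs≤lcf S k X Y m (_ , maximal) s
    (p , q , _ , _ , _ , _ , a , b , p+q≡k ,
     (i , _ , _ , _ , refl , refl) , (j , _ , _ , _ , refl , refl) ,
     ((a≤U₁ , a≤V₁ , da≤p) , _) , ((b≤U₂ , b≤V₂ , db≤q) , _) , refl) =
    maximal (a + b) (F , G , gluedFactor X (i ∸ 1) a b a≤U₁ b≤U₂ ,
                             gluedFactor Y (j ∸ 1) a b a≤V₁ b≤V₂ , dFG≤k)
    where
    U₁ = reverse (take (i ∸ 1) X)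
    V₁ = reverse (take (j ∸ 1) Y)
    U₂ = drop (i ∸ 1) X
    V₂ = drop (j ∸ 1) Y
    F = reverse (take a U₁) ++ take b U₂
    G = reverse (take a V₁) ++ take b V₂
    |a₁|≡|a₂| : length (take a U₁) ≡ length (take a V₁)
    |a₁|≡|a₂| = trans (length-take-≤ a U₁ a≤U₁) (sym (length-take-≤ a V₁ a≤V₁))
    dFG≤k : d F G ≤ k
    dFG≤k = begin
      d F G
        ≡⟨ dH-++ (reverse (take a U₁)) (reverse (take a V₁)) _ _
             (trans (length-reverse (take a U₁)) (trans |a₁|≡|a₂| (sym (length-reverse (take a V₁))))) ⟩
      d (reverse (take a U₁)) (reverse (take a V₁)) + d (take b U₂) (take b V₂)
        ≡⟨ cong (_+ d (take b U₂) (take b V₂)) (dH-reverse (take a U₁) (take a V₁) |a₁|≡|a₂|) ⟩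
      d (take a U₁) (take a V₁) + d (take b U₂) (take b V₂) ≤⟨ +-mono-≤ da≤p db≤q ⟩
      p + q                                                 ≡⟨ p+q≡k ⟩
      k ∎
      where open ≤-Reasoning

  lcp-exists : ∀ e (U V : List A) → ∃ (IsLCP eq? e U V)
  lcp-exists e U V = boundedMax (LCPCand eq? e U V)
    (λ n → (n ≤? length U) ×-dec ((n ≤? length V) ×-dec (d (take n U) (take n V) ≤? e)))
    (z≤n , z≤n , z≤n) (length U) (λ n → proj₁)

  common-prefix≤LCP : ∀ e (T W T′ W′ : List A) {a : ℕ} → length T ≡ length T′ → d T T′ ≤ e →
                      IsLCP eq? e (T ++ W) (T′ ++ W′) a → length T ≤ a
  common-prefix≤LCP e T W T′ W′ |T|≡|T′| dTT′≤e (_ , maximal) =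
    maximal (length T) (T≤ , T′≤ , subst₂ (λ x y → d x y ≤ e) (sym takeT) (sym takeT′) dTT′≤e)
    where
    T≤ : length T ≤ length (T ++ W)
    T≤ = subst (length T ≤_) (sym (length-++ T)) (m≤m+n _ _)
    T′≤ : length T ≤ length (T′ ++ W′)
    T′≤ = subst (_≤ length (T′ ++ W′)) (sym |T|≡|T′|) (subst (length T′ ≤_) (sym (length-++ T′)) (m≤m+n _ _))
    takeT : take (length T) (T ++ W) ≡ T
    takeT = trans (take-++-≤ (length T) T W ≤-refl) (take-all (length T) T ≤-refl)
    takeT′ : take (length T) (T′ ++ W′) ≡ T′
    takeT′ = trans (take-++-≤ (length T) T′ W′ (≤-reflexive |T|≡|T′|))
                   (take-all (length T) T′ (≤-reflexive (sym |T|≡|T′|)))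

  anchored-pair : (S : ℕ → Set) (h : ℕ) (u F v : List A) → h < length F →
    S (suc (length u + h)) →
    InPairs eq? S (u ++ (F ++ v)) (reverse (take h F) ++ reverse u) (drop h F ++ v)
  anchored-pair S h u F v h<|F| anchor =
    suc (length u + h) , s≤s z≤n , i≤|X| , anchor , sym (proj₁ cut) , sym (proj₂ cut)
    where
    cut = cut-inside h u F v (<⇒≤ h<|F|)
    i≤|X| : suc (length u + h) ≤ length (u ++ (F ++ v))
    i≤|X| = begin
      suc (length u + h)            ≡⟨ sym (+-suc (length u) h) ⟩
      length u + suc h              ≤⟨ +-monoʳ-≤ (length u) (≤-trans h<|F| (m≤m+n _ _)) ⟩
      length u + (length F + length v) ≡⟨ cong (length u +_) (sym (length-++ F)) ⟩
      length u + length (F ++ v)    ≡⟨ sym (length-++ u) ⟩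
      length (u ++ (F ++ v))        ∎
      where open ≤-Reasoning

  -- An approximate match F, G cut at anchored positions h characters in yields
  -- a candidate of value at least |F|: take q = mismatches right of the cut and
  -- p = k - q.
  cut-candidate : (S : ℕ → Set) (k : ℕ) (u F v u′ G v′ : List A) (h : ℕ) →
    length F ≡ length G → h < length F → d F G ≤ k →
    S (suc (length u + h)) → S (suc (length u′ + h)) →
    ∃[ s ] (RHSCand eq? S k (u ++ (F ++ v)) (u′ ++ (G ++ v′)) s × length F ≤ s)
  cut-candidate S k u F v u′ G v′ h |F|≡|G| h<|F| dFG≤k anchorX anchorY =
    a + b , (p , q , _ , _ , _ , _ , a , b , p+q≡k ,
             anchored-pair S h u F v h<|F| anchorX ,
             anchored-pair S h u′ G v′ h<|G| anchorY , isA , isB , refl) , |F|≤a+b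
    where
    h<|G| = subst (h <_) |F|≡|G| h<|F|
    |Fₕ| : length (take h F) ≡ h
    |Fₕ| = length-take-≤ h F (<⇒≤ h<|F|)
    |Fₕ|≡|Gₕ| : length (take h F) ≡ length (take h G)
    |Fₕ|≡|Gₕ| = trans |Fₕ| (sym (length-take-≤ h G (<⇒≤ h<|G|)))
    q = d (drop h F) (drop h G)
    p = k ∸ q
    split≤k : d (take h F) (take h G) + q ≤ k
    split≤k = subst (_≤ k) (dH-split h F G |F|≡|G|) dFG≤k
    p+q≡k : p + q ≡ k
    p+q≡k = m∸n+n≡m (m+n≤o⇒n≤o (d (take h F) (take h G)) split≤k)
    lcpA = lcp-exists p (reverse (take h F) ++ reverse u) (reverse (take h G) ++ reverse u′)
    lcpB = lcp-exists q (drop h F ++ v) (drop h G ++ v′)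
    a = proj₁ lcpA
    isA = proj₂ lcpA
    b = proj₁ lcpB
    isB = proj₂ lcpB
    h≤a : h ≤ a
    h≤a = subst (_≤ a) (trans (length-reverse (take h F)) |Fₕ|)
      (common-prefix≤LCP p (reverse (take h F)) (reverse u) (reverse (take h G)) (reverse u′)
        (trans (length-reverse (take h F)) (trans |Fₕ|≡|Gₕ| (sym (length-reverse (take h G)))))
        (subst (_≤ p) (sym (dH-reverse (take h F) (take h G) |Fₕ|≡|Gₕ|)) (m+n≤o⇒m≤o∸n _ split≤k))
        isA)
    rest≤b : length F ∸ h ≤ b
    rest≤b = subst (_≤ b) (length-drop h F)
      (common-prefix≤LCP q (drop h F) v (drop h G) v′
        (trans (length-drop h F) (trans (cong (_∸ h) |F|≡|G|) (sym (length-drop h G)))) ≤-refl isB)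
    |F|≤a+b : length F ≤ a + b
    |F|≤a+b = subst (_≤ a + b) (m+[n∸m]≡n (<⇒≤ h<|F|)) (+-mono-≤ h≤a rest≤b)

  lcf-attained : (S : ℕ → Set) (k ℓ : ℕ) → IsCover ℓ S → (X Y : List A) (m : ℕ) →
                 IsLCF eq? k X Y m → ℓ ≤ m → RHSCand eq? S k X Y m
  lcf-attained S k ℓ (h , cover) X Y m
    lcf@((F , G , (|F|≡m , u , v , refl) , (|G|≡m , u′ , v′ , refl) , dFG≤k) , _) ℓ≤m
    with cover (suc (length u)) (suc (length u′)) (s≤s z≤n) (s≤s z≤n)
  ... | hᵤ<ℓ , anchorX , anchorY
    with cut-candidate S k u F v u′ G v′ _ (trans |F|≡m (sym |G|≡m))
           (subst (_ <_) (sym |F|≡m) (≤-trans hᵤ<ℓ ℓ≤m)) dFG≤k anchorX anchorY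
  ... | s , candidate , |F|≤s = subst (RHSCand eq? S k X Y) s≡m candidate
    where
    s≡m : s ≡ m
    s≡m = ≤-antisym (rhs≤lcf S k X Y m lcf s candidate) (subst (_≤ s) |F|≡m |F|≤s)

lemma4 : {A : Set} (eq? : DecidableEquality A) (X Y : List A) (k ℓ : ℕ) → 1 ≤ ℓ →
    (S : ℕ → Set) → IsCover ℓ S →
    (m : ℕ) → IsLCF eq? k X Y m → ℓ ≤ m →
    IsMax (RHSCand eq? S k X Y) m
lemma4 eq? X Y k ℓ _ S cov m lcf ℓ≤m = lcf-attained eq? S k ℓ cov X Y m lcf ℓ≤m , rhs≤lcf eq? S k X Y m lcf
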